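{- Let $U$ be a sunshine graph and $T$ a caterpillar of order $n$ with $b(U,T)\ge 5$, and let $U^+$ be a sunshine supercard of $U$ and $T$ (with $w,v$, labelling and $\chi$ as in the context) chosen so that $\chi(U^+)$ is largest possible among all sunshine supercards of $U$ and $T$. Suppose there exists an automorphism $\lambda$ of $U^+$ that lies in $B_U$, acts as a rotation of the cycle (i.e. $\lambda(x_i)=x_{\alpha+i}$ for all $i$, for some fixed $\alpha$), and satisfies $\lambda(x_0)\ne x_0$. Then $B_U=\mathrm{Aut}(U^+)$.
   Context: All graphs are finite and simple. The deck of $G$ is the multiset of unlabelled cards $G-v$; $b(G,H)$ is the cardinality of the multiset intersection of the decks. The skeleton of a graph is obtained by deleting all vertices of degree $0$ or $1$; sunshine graph: connected, skeleton a cycle; caterpillar: connected, skeleton a path. A supercard of $U$ and $T$ is a graph of order $n+1$ whose deck contains cards isomorphic to $U$ and to $T$. For a sunshine supercard $U^+$, fix $w,v$ with $U^+-w\cong U$, $U^+-v\cong T$ ($w$ a leaf, $v$ a degree-2 cycle vertex); identify $U=U^+-w$, $T=U^+-v$. Label the cycle $x_0\ldots x_{c-1}x_0$ (indices mod $c$) with $x_0$ adjacent to $w$, $v=x_\nu$, $d_{U^+}(x_{\nu-1})\ge d_{U^+}(x_{\nu+1})$. Write $\lambda(G)=H$ if the bijection $\lambda$ is an isomorphism from $G$ onto $H$. $B_{vw}(U^+)=\{\lambda\in\mathrm{Sym}(V(U^+)):\lambda(U-\lambda^{ -1}(v))=T-\lambda(w)\}$, $B_U=\{\lambda\in B_{vw}(U^+):\lambda(U)=U^+-\lambda(w)\}$.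 A maximum saturating set is $X\subseteq B_{vw}(U^+)$ with: the identity in $X$; distinct $\lambda,\pi\in X$ have $\lambda^{ -1}(v)\ne\pi^{ -1}(v)$ and $\lambda(w)\ne\pi(w)$; and no $\sigma\in B_{vw}(U^+)\setminus X$ can be added keeping the previous property. $\chi(U^+)=\max|X\cap B_U|$ over maximum saturating sets $X$. -}

module Defs where

open import Data.Nat using (ℕ; zero; suc; _+_; _≤_)
open import Data.Nat.DivMod using (_mod_)
open import Data.Fin using (Fin; toℕ; punchIn; _≟_)
open import Data.Fin.Properties using (all?)
open import Data.Fin.Permutation using (Permutation′; _⟨$⟩ʳ_; _⟨$⟩ˡ_)
open import Data.Bool using (Bool; true; false; if_then_else_)
import Data.Bool.Properties as BoolP
open import Data.List using (List; map; allFin; filter; length)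
open import Data.Nat.ListAction using (sum)
open import Data.List.Relation.Unary.All using (All)
open import Data.List.Relation.Unary.Any using (Any)
open import Data.List.Relation.Unary.AllPairs using (AllPairs)
open import Data.Product using (Σ; Σ-syntax; ∃; _×_; _,_)
open import Data.Sum using (_⊎_)
open import Relation.Binary.PropositionalEquality using (_≡_; _≢_)
open import Relation.Nullary using (¬_; Dec; ¬?; _×-dec_)
open import Relation.Nullary.Decidable using (_→-dec_)

record Graph (n : ℕ) : Set where
  field
    adj    : Fin n → Fin n → Bool
    sym    : ∀ i j → adj i j ≡ adj j i
    irrefl : ∀ i → adj i i ≡ false
open Graph public

deg : ∀ {n} → Graph n → Fin n → ℕ
deg {n} G u = sum (map (λ j → if adj G u j then 1 else 0) (allFin n))

_≅_ : ∀ {n} → Graph n → Graph n → Set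
_≅_ {n} G H = Σ[ π ∈ Permutation′ n ] (∀ a b → adj G a b ≡ adj H (π ⟨$⟩ʳ a) (π ⟨$⟩ʳ b))

card : ∀ {n} → Graph (suc n) → Fin (suc n) → Graph n
card G v = record
  { adj    = λ i j → adj G (punchIn v i) (punchIn v j)
  ; sym    = λ i j → sym G (punchIn v i) (punchIn v j)
  ; irrefl = λ i → irrefl G (punchIn v i) }

-- b(G,H) ≥ k : the multiset intersection of the decks of G and H has at
-- least k elements, i.e. there are k distinct vertices of G and k distinct
-- vertices of H, matched so that matched cards are isomorphic.
DeckCommon≥ : ∀ {n} → ℕ → Graph (suc n) → Graph (suc n) → Set
DeckCommon≥ {n} k G H =
  Σ[ f ∈ (Fin k → Fin (suc n)) ] Σ[ g ∈ (Fin k → Fin (suc n)) ]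
    (∀ i j → f i ≡ f j → i ≡ j) × (∀ i j → g i ≡ g j → i ≡ j) ×
    (∀ i → card G (f i) ≅ card H (g i))

data Reach {n} (G : Graph n) : Fin n → Fin n → Set where
  here : ∀ {a} → Reach G a a
  step : ∀ {a b c} → adj G a b ≡ true → Reach G b c → Reach G a c

Connected : ∀ {n} → Graph n → Set
Connected {n} G = ∀ (a b : Fin n) → Reach G a b

-- Skeleton = subgraph induced on the vertices of degree ≥ 2.

sucMod : ∀ {k} → Fin (3 + k) → Fin (3 + k)
sucMod {k} i = (toℕ i + 1) mod (3 + k)

addMod : ∀ {k} → Fin (3 + k) → Fin (3 + k) → Fin (3 + k)
addMod {k} i j = (toℕ i + toℕ j) mod (3 + k)

predMod : ∀ {k} → Fin (3 + k) → Fin (3 + k)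
predMod {k} i = (toℕ i + (2 + k)) mod (3 + k)

-- x₀ … x_{c-1} (c = 3 + k) is a labelling of the skeleton of G as a cycle:
-- x is an isomorphism from the cycle C_c onto the skeleton of G.
IsSkeletonCycle : ∀ {n} (G : Graph n) (k : ℕ) → (Fin (3 + k) → Fin n) → Set
IsSkeletonCycle {n} G k x =
  (∀ i j → x i ≡ x j → i ≡ j) ×
  (∀ i → 2 ≤ deg G (x i)) ×
  (∀ u → 2 ≤ deg G u → ∃ λ i → x i ≡ u) ×
  (∀ i j → (adj G (x i) (x j) ≡ true → (j ≡ sucMod i ⊎ i ≡ sucMod j)) ×
           ((j ≡ sucMod i ⊎ i ≡ sucMod j) → adj G (x i) (x j) ≡ true))

IsSkeletonPath : ∀ {n} (G : Graph n) (l : ℕ) → (Fin l → Fin n) → Set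
IsSkeletonPath {n} G l p =
  (∀ i j → p i ≡ p j → i ≡ j) ×
  (∀ i → 2 ≤ deg G (p i)) ×
  (∀ u → 2 ≤ deg G u → ∃ λ i → p i ≡ u) ×
  (∀ i j → (adj G (p i) (p j) ≡ true → (toℕ j ≡ suc (toℕ i) ⊎ toℕ i ≡ suc (toℕ j))) ×
           ((toℕ j ≡ suc (toℕ i) ⊎ toℕ i ≡ suc (toℕ j)) → adj G (p i) (p j) ≡ true))

Sunshine : ∀ {n} → Graph n → Set
Sunshine G = Connected G × Σ[ k ∈ ℕ ] Σ[ x ∈ (Fin (3 + k) → _) ] IsSkeletonCycle G k x

Caterpillar : ∀ {n} → Graph n → Set
Caterpillar G = Connected G × Σ[ l ∈ ℕ ] Σ[ p ∈ (Fin l → _) ] IsSkeletonPath G l p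

-- The sets B_vw(U⁺), B_U and Aut(U⁺).  U = U⁺ - w, T = U⁺ - v, both
-- regarded as induced subgraphs of U⁺.

module _ {N : ℕ} (G : Graph N) (w v : Fin N) where

  -- λ ∈ B_vw(U⁺): λ(U - λ⁻¹(v)) = T - λ(w).  (λ⁻¹(v) must be a vertex of U,
  -- i.e. λ⁻¹(v) ≠ w, equivalently λ(w) ≠ v.)
  InBvw : Permutation′ N → Set
  InBvw σ = (σ ⟨$⟩ʳ w ≢ v) ×
    (∀ a b → a ≢ w → a ≢ σ ⟨$⟩ˡ v → b ≢ w → b ≢ σ ⟨$⟩ˡ v →
       adj G a b ≡ adj G (σ ⟨$⟩ʳ a) (σ ⟨$⟩ʳ b))

  -- λ ∈ B_U: additionally λ(U) = U⁺ - λ(w)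
  InBU : Permutation′ N → Set
  InBU σ = InBvw σ ×
    (∀ a b → a ≢ w → b ≢ w → adj G a b ≡ adj G (σ ⟨$⟩ʳ a) (σ ⟨$⟩ʳ b))

  inBU? : ∀ σ → Dec (InBU σ)
  inBU? σ =
    (¬? (σ ⟨$⟩ʳ w ≟ v) ×-dec
      all? (λ a → all? (λ b →
        ¬? (a ≟ w) →-dec (¬? (a ≟ σ ⟨$⟩ˡ v) →-dec (¬? (b ≟ w) →-dec
          (¬? (b ≟ σ ⟨$⟩ˡ v) →-dec
            BoolP._≟_ (adj G a b) (adj G (σ ⟨$⟩ʳ a) (σ ⟨$⟩ʳ b))))))))
    ×-dec
    all? (λ a → all? (λ b → ¬? (a ≟ w) →-dec (¬? (b ≟ w) →-dec
      BoolP._≟_ (adj G a b) (adj G (σ ⟨$⟩ʳ a) (σ ⟨$⟩ʳ b)))))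

  _≈ₚ_ : Permutation′ N → Permutation′ N → Set
  σ ≈ₚ π = ∀ i → σ ⟨$⟩ʳ i ≡ π ⟨$⟩ʳ i

  Compat : Permutation′ N → Permutation′ N → Set
  Compat σ π = (σ ⟨$⟩ˡ v ≢ π ⟨$⟩ˡ v) × (σ ⟨$⟩ʳ w ≢ π ⟨$⟩ʳ w)

  MaxSaturating : List (Permutation′ N) → Set
  MaxSaturating X =
    All InBvw X ×
    Any (λ π → ∀ i → π ⟨$⟩ʳ i ≡ i) X ×
    AllPairs Compat X ×
    (∀ σ → InBvw σ → ¬ Any (σ ≈ₚ_) X → ¬ All (Compat σ) X)

  countBU : List (Permutation′ N) → ℕ
  countBU X = length (filter inBU? X)

  ChiIs : ℕ → Set
  ChiIs k = (Σ[ X ∈ List (Permutation′ N) ] MaxSaturating X × countBU X ≡ k) ×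
            (∀ X → MaxSaturating X → countBU X ≤ k)

IsAut : ∀ {N} → Graph N → Permutation′ N → Set
IsAut G σ = ∀ a b → adj G a b ≡ adj G (σ ⟨$⟩ʳ a) (σ ⟨$⟩ʳ b)

SunshineSupercard : ∀ {n} → Graph (suc n) → Graph (suc n) →
                    Graph (suc (suc n)) → Fin (suc (suc n)) → Fin (suc (suc n)) → Set
SunshineSupercard U T U⁺ w v =
  Sunshine U⁺ × deg U⁺ w ≡ 1 × deg U⁺ v ≡ 2 × card U⁺ w ≅ U × card U⁺ v ≅ T

module Submission where

-- π ∈ B_U preserves adjacency away from the leaf w, so comparing neighbourhoods gives
-- deg (π u) + [u ~ w] = deg u + [π u ~ π w] for u ≠ w, and double counting gives
-- deg (π w) = deg w = 1.  Each π x_i keeps its two cycle neighbours, hence lies on the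
-- cycle, and π acts on the cycle as a rotation or a reflection; either way the rotation
-- σ carries the step x₀ ↦ x_α to a step along one σ-orbit, so deg (π x_α) = deg (π x₀).
-- If π x₀ were not adjacent to π w we would get
-- deg (π x₀) < deg x₀ = deg x_α ≤ deg (π x_α) = deg (π x₀).  So the leaf π w hangs at
-- π x₀, and π is an automorphism.  Conversely an automorphism preserves degrees and so
-- cannot send the leaf w to the degree-2 vertex v.

open import Defs hiding (sym)
open import Data.Nat using (ℕ; zero; suc; _+_; _*_; _%_; _/_; _≤_; s≤s)
import Data.Nat.Properties as ℕ
open import Data.Nat.Properties using (+-comm; +-assoc; +-identityʳ; +-cancelˡ-≡; m≤m+n; m≤n+m)
open import Data.Nat.DivMod using (_mod_; m<n⇒m%n≡m; [m+n]%n≡m%n; %-distribˡ-+; m%n%n≡m%n; m≡m%n+[m/n]*n)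
import Data.Nat.ListAction as List
open import Data.Fin using (Fin; zero; suc; toℕ; punchIn; punchOut)
open import Data.Fin.Properties using (_≟_; toℕ-fromℕ<; toℕ-injective; toℕ<n; punchInᵢ≢i; punchIn-punchOut)
import Data.Fin.Permutation as Perm
open import Data.Fin.Permutation using (Permutation′; _⟨$⟩ʳ_)
open import Data.Bool using (Bool; true; false; if_then_else_)
open import Data.Bool.Properties using (⇔→≡)
open import Data.List using (tabulate)
open import Data.List.Properties using (map-tabulate)
open import Data.Empty using (⊥-elim)
open import Data.Product using (∃; _×_; _,_; proj₁; proj₂)
open import Data.Sum using (_⊎_; inj₁; inj₂)
open import Function using (_∘_; id)
open import Function.Bundles using (Injection; mk⇔)
open import Function.Properties.Inverse using (↔⇒↣)
open import Relation.Binary.PropositionalEquality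
open import Relation.Nullary using (yes; no)
import Algebra.Properties.CommutativeMonoid.Sum as Sum
open Sum ℕ.+-0-commutativeMonoid using (sum; sum-remove; sum-permute; ∑-distrib-+; sum-cong-≗)

indicator : Bool → ℕ
indicator b = if b then 1 else 0

sum-tabulate : ∀ {n} (f : Fin n → ℕ) → List.sum (tabulate f) ≡ sum f
sum-tabulate {zero}  f = refl
sum-tabulate {suc n} f = cong (f zero +_) (sum-tabulate (f ∘ suc))

term≤sum : ∀ {n} (f : Fin n → ℕ) i → f i ≤ sum f
term≤sum f zero    = m≤m+n (f zero) _
term≤sum f (suc i) = ℕ.≤-trans (term≤sum (f ∘ suc) i) (m≤n+m _ (f zero))

m+m≡n+n⇒m≡n : ∀ {m n} → m + m ≡ n + n → m ≡ n
m+m≡n+n⇒m≡n {zero}  {zero}  _  = refl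
m+m≡n+n⇒m≡n {suc m} {suc n} eq =
  cong suc (m+m≡n+n⇒m≡n (ℕ.suc-injective (trans (sym (ℕ.+-suc m m)) (trans (ℕ.suc-injective eq) (ℕ.+-suc n n)))))

module _ {n} (G : Graph n) where

  deg≡sum : ∀ u → deg G u ≡ sum (λ j → indicator (adj G u j))
  deg≡sum u = trans (cong List.sum (map-tabulate id (λ j → indicator (adj G u j))))
                    (sum-tabulate {n} (λ j → indicator (adj G u j)))

  deg-permute : (π : Permutation′ n) → ∀ u → deg G u ≡ sum (λ j → indicator (adj G u (π ⟨$⟩ʳ j)))
  deg-permute π u = trans (deg≡sum u) (sum-permute _ π)

  deg-aut : (σ : Permutation′ n) → IsAut G σ → ∀ u → deg G (σ ⟨$⟩ʳ u) ≡ deg G u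
  deg-aut σ σ-aut u = begin
    deg G (σ ⟨$⟩ʳ u)                                     ≡⟨ deg-permute σ (σ ⟨$⟩ʳ u) ⟩
    sum (λ j → indicator (adj G (σ ⟨$⟩ʳ u) (σ ⟨$⟩ʳ j))) ≡⟨ sum-cong-≗ (λ j → cong indicator (sym (σ-aut u j))) ⟩
    sum (λ j → indicator (adj G u j))                    ≡⟨ deg≡sum u ⟨
    deg G u                                              ∎
    where open ≡-Reasoning

module _ {n} (G : Graph (suc n)) where

  degOff : Fin (suc n) → Fin (suc n) → ℕ
  degOff w u = sum (λ i → indicator (adj G u (punchIn w i)))

  deg-remove : ∀ w u → deg G u ≡ indicator (adj G u w) + degOff w u
  deg-remove w u = trans (deg≡sum G u) (sum-remove {i = w} (λ j → indicator (adj G u j)))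

  pair≤deg : ∀ u {a b} → a ≢ b → indicator (adj G u a) + indicator (adj G u b) ≤ deg G u
  pair≤deg u {a} {b} a≢b = begin
    indicator (adj G u a) + indicator (adj G u b)
      ≡⟨ cong (λ (c : Fin (suc n)) → indicator (adj G u a) + indicator (adj G u c)) (punchIn-punchOut a≢b) ⟨
    indicator (adj G u a) + indicator (adj G u (punchIn a (punchOut a≢b)))
      ≤⟨ ℕ.+-monoʳ-≤ _ (term≤sum _ (punchOut a≢b)) ⟩
    indicator (adj G u a) + degOff a u
      ≡⟨ deg-remove a u ⟨
    deg G u ∎
    where open ℕ.≤-Reasoning

  two-neighbours⇒2≤deg : ∀ u {a b} → a ≢ b → adj G u a ≡ true → adj G u b ≡ true → 2 ≤ deg G u
  two-neighbours⇒2≤deg u a≢b u~a u~b =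
    subst (λ s → s ≤ deg G u) (cong₂ (λ p q → indicator p + indicator q) u~a u~b) (pair≤deg u a≢b)

  leaf-neighbour-unique : ∀ u {a b} → deg G u ≡ 1 → adj G u a ≡ true → adj G u b ≡ true → a ≡ b
  leaf-neighbour-unique u {a} {b} deg-u u~a u~b with a ≟ b
  ... | yes a≡b = a≡b
  ... | no a≢b with subst (2 ≤_) deg-u (two-neighbours⇒2≤deg u a≢b u~a u~b)
  ... | s≤s ()

  deg≡sum-others : (ρ : Permutation′ (suc n)) → ∀ w →
    deg G (ρ ⟨$⟩ʳ w) ≡ sum (λ i → indicator (adj G (ρ ⟨$⟩ʳ punchIn w i) (ρ ⟨$⟩ʳ w)))
  deg≡sum-others ρ w = begin
    deg G (ρ ⟨$⟩ʳ w)
      ≡⟨ deg-permute G ρ (ρ ⟨$⟩ʳ w) ⟩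
    sum (λ j → indicator (adj G (ρ ⟨$⟩ʳ w) (ρ ⟨$⟩ʳ j)))
      ≡⟨ sum-remove {i = w} (λ j → indicator (adj G (ρ ⟨$⟩ʳ w) (ρ ⟨$⟩ʳ j))) ⟩
    indicator (adj G (ρ ⟨$⟩ʳ w) (ρ ⟨$⟩ʳ w)) + sum (λ i → indicator (adj G (ρ ⟨$⟩ʳ w) (ρ ⟨$⟩ʳ punchIn w i)))
      ≡⟨ cong₂ _+_ (cong indicator (irrefl G (ρ ⟨$⟩ʳ w)))
                   (sum-cong-≗ {n} (λ i → cong indicator (Graph.sym G (ρ ⟨$⟩ʳ w) _))) ⟩
    sum (λ i → indicator (adj G (ρ ⟨$⟩ʳ punchIn w i) (ρ ⟨$⟩ʳ w))) ∎
    where open ≡-Reasoning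

module OffVertex {n} (G : Graph (suc n)) (w : Fin (suc n)) (π : Permutation′ (suc n))
  (π-off-w : ∀ a b → a ≢ w → b ≢ w → adj G a b ≡ adj G (π ⟨$⟩ʳ a) (π ⟨$⟩ʳ b)) where

  deg-image : ∀ u → u ≢ w → deg G (π ⟨$⟩ʳ u) ≡ indicator (adj G (π ⟨$⟩ʳ u) (π ⟨$⟩ʳ w)) + degOff G w u
  deg-image u u≢w = begin
    deg G (π ⟨$⟩ʳ u)
      ≡⟨ deg-permute G π (π ⟨$⟩ʳ u) ⟩
    sum (λ j → indicator (adj G (π ⟨$⟩ʳ u) (π ⟨$⟩ʳ j)))
      ≡⟨ sum-remove {i = w} (λ j → indicator (adj G (π ⟨$⟩ʳ u) (π ⟨$⟩ʳ j))) ⟩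
    indicator (adj G (π ⟨$⟩ʳ u) (π ⟨$⟩ʳ w)) + sum (λ i → indicator (adj G (π ⟨$⟩ʳ u) (π ⟨$⟩ʳ punchIn w i)))
      ≡⟨ cong (indicator (adj G (π ⟨$⟩ʳ u) (π ⟨$⟩ʳ w)) +_) (sum-cong-≗ {n} λ i → cong indicator (sym (π-off-w u (punchIn w i) u≢w (punchInᵢ≢i w i)))) ⟩
    indicator (adj G (π ⟨$⟩ʳ u) (π ⟨$⟩ʳ w)) + degOff G w u ∎
    where open ≡-Reasoning

  -- Double counting: summing deg-image and deg-remove over all u ≢ w shows that
  -- deg (π w) - deg w and deg w - deg (π w) are the same number.
  deg-image-centre : deg G (π ⟨$⟩ʳ w) ≡ deg G w
  deg-image-centre = sym (m+m≡n+n⇒m≡n (ℕ.+-cancelʳ-≡ E _ _ (begin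
    deg G w + deg G w + E           ≡⟨ +-assoc (deg G w) _ E ⟩
    deg G w + (deg G w + E)         ≡⟨ cong (deg G w +_) others ⟨
    deg G w + sum (deg G ∘ other)   ≡⟨ sum-remove {i = w} (deg G) ⟨
    sum (deg G)                     ≡⟨ sum-permute (deg G) π ⟩
    sum (deg G ∘ (π ⟨$⟩ʳ_))          ≡⟨ sum-remove {i = w} (deg G ∘ (π ⟨$⟩ʳ_)) ⟩
    deg G (π ⟨$⟩ʳ w) + sum (λ i → deg G (π ⟨$⟩ʳ other i))
                                    ≡⟨ cong (deg G (π ⟨$⟩ʳ w) +_) images ⟩
    deg G (π ⟨$⟩ʳ w) + (deg G (π ⟨$⟩ʳ w) + E)
                                    ≡⟨ +-assoc (deg G (π ⟨$⟩ʳ w)) _ E ⟨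
    deg G (π ⟨$⟩ʳ w) + deg G (π ⟨$⟩ʳ w) + E ∎)))
    where
    open ≡-Reasoning
    other : Fin n → Fin (suc n)
    other = punchIn w
    E : ℕ
    E = sum (λ i → degOff G w (other i))
    others : sum (deg G ∘ other) ≡ deg G w + E
    others = begin
      sum (deg G ∘ other)
        ≡⟨ sum-cong-≗ {n} (λ i → deg-remove G w (other i)) ⟩
      sum (λ i → indicator (adj G (other i) w) + degOff G w (other i))
        ≡⟨ ∑-distrib-+ {n} _ _ ⟩
      sum (λ i → indicator (adj G (other i) w)) + E
        ≡⟨ cong (_+ E) (deg≡sum-others G Perm.id w) ⟨
      deg G w + E ∎
    images : sum (λ i → deg G (π ⟨$⟩ʳ other i)) ≡ deg G (π ⟨$⟩ʳ w) + E
    images = begin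
      sum (λ i → deg G (π ⟨$⟩ʳ other i))
        ≡⟨ sum-cong-≗ {n} (λ i → deg-image (other i) (punchInᵢ≢i w i)) ⟩
      sum (λ i → indicator (adj G (π ⟨$⟩ʳ other i) (π ⟨$⟩ʳ w)) + degOff G w (other i))
        ≡⟨ ∑-distrib-+ {n} _ _ ⟩
      sum (λ i → indicator (adj G (π ⟨$⟩ʳ other i) (π ⟨$⟩ʳ w))) + E
        ≡⟨ cong (_+ E) (deg≡sum-others G π w) ⟨
      deg G (π ⟨$⟩ʳ w) + E ∎

module _ {k : ℕ} where

  private
    c : ℕ
    c = 3 + k

  toℕ-mod : ∀ m → toℕ (m mod c) ≡ m % c
  toℕ-mod m = toℕ-fromℕ< _

  mod-cong : ∀ m n → m % c ≡ n % c → m mod c ≡ n mod c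
  mod-cong m n eq = toℕ-injective (trans (toℕ-mod m) (trans eq (sym (toℕ-mod n))))

  toℕ-mod-inverse : (i : Fin c) → toℕ i mod c ≡ i
  toℕ-mod-inverse i = toℕ-injective (trans (toℕ-mod (toℕ i)) (m<n⇒m%n≡m (toℕ<n i)))

  mod-+ : ∀ m n → (toℕ (m mod c) + n) mod c ≡ (m + n) mod c
  mod-+ m n = mod-cong (toℕ (m mod c) + n) (m + n) (begin
    (toℕ (m mod c) + n) % c    ≡⟨ cong (λ t → (t + n) % c) (toℕ-mod m) ⟩
    (m % c + n) % c            ≡⟨ %-distribˡ-+ (m % c) n c ⟩
    (m % c % c + n % c) % c    ≡⟨ cong (λ t → (t + n % c) % c) (m%n%n≡m%n m c) ⟩
    (m % c + n % c) % c        ≡⟨ %-distribˡ-+ m n c ⟨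
    (m + n) % c                ∎)
    where open ≡-Reasoning

  rotate : ℕ → Fin c → Fin c
  rotate zero    i = i
  rotate (suc n) i = sucMod (rotate n i)

  rotate≡mod : ∀ n i → rotate n i ≡ (toℕ i + n) mod c
  rotate≡mod zero    i = sym (trans (cong (_mod c) (+-identityʳ (toℕ i))) (toℕ-mod-inverse i))
  rotate≡mod (suc n) i = begin
    (toℕ (rotate n i) + 1) mod c        ≡⟨ cong (λ j → (toℕ j + 1) mod c) (rotate≡mod n i) ⟩
    (toℕ ((toℕ i + n) mod c) + 1) mod c ≡⟨ mod-+ (toℕ i + n) 1 ⟩
    (toℕ i + n + 1) mod c               ≡⟨ cong (_mod c) (trans (+-assoc (toℕ i) n 1) (cong (toℕ i +_) (+-comm n 1))) ⟩
    (toℕ i + suc n) mod c               ∎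
    where open ≡-Reasoning

  rotate-sucMod : ∀ n i → rotate n (sucMod i) ≡ rotate (suc n) i
  rotate-sucMod zero    i = refl
  rotate-sucMod (suc n) i = cong sucMod (rotate-sucMod n i)

  addMod≡rotate : ∀ i j → addMod i j ≡ rotate (toℕ j) i
  addMod≡rotate i j = sym (rotate≡mod (toℕ j) i)

  rotate-zero : ∀ j → rotate (toℕ j) zero ≡ j
  rotate-zero j = trans (rotate≡mod (toℕ j) zero) (toℕ-mod-inverse j)

  rotate-by-complement : ∀ i p q → p + q ≡ c → (toℕ ((toℕ i + p) mod c) + q) mod c ≡ i
  rotate-by-complement i p q p+q≡c = trans (mod-+ (toℕ i + p) q)
    (trans (mod-cong (toℕ i + p + q) (toℕ i)
             (trans (cong (_% c) (trans (+-assoc (toℕ i) p q) (cong (toℕ i +_) p+q≡c))) ([m+n]%n≡m%n (toℕ i) c)))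
           (toℕ-mod-inverse i))

  predMod-sucMod : ∀ i → predMod (sucMod i) ≡ i
  predMod-sucMod i = rotate-by-complement i 1 (2 + k) refl

  sucMod-predMod : ∀ i → sucMod (predMod i) ≡ i
  sucMod-predMod i = rotate-by-complement i (2 + k) 1 (+-comm (2 + k) 1)

  sucMod-injective : ∀ {i j} → sucMod i ≡ sucMod j → i ≡ j
  sucMod-injective {i} {j} eq = trans (sym (predMod-sucMod i)) (trans (cong predMod eq) (predMod-sucMod j))

  -- t + 2 ≡ t + q * c would force 2 ≡ q * c, impossible for c ≥ 3
  sucMod²≢id : ∀ i → sucMod (sucMod i) ≢ i
  sucMod²≢id i eq = 2≢multiple q (+-cancelˡ-≡ t 2 (q * c) (trans (m≡m%n+[m/n]*n (t + 2) c) (cong (_+ q * c) t+2%c≡t)))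
    where
    t = toℕ i
    q = (t + 2) / c
    t+2%c≡t : (t + 2) % c ≡ t
    t+2%c≡t = trans (sym (toℕ-mod (t + 2))) (cong toℕ (trans (sym (rotate≡mod 2 i)) eq))
    2≢multiple : ∀ p → 2 ≢ p * c
    2≢multiple zero    ()
    2≢multiple (suc p) ()

module NonBacktrackingWalk {k : ℕ} (f : ℕ → Fin (3 + k))
  (step : ∀ n → f (suc n) ≡ sucMod (f n) ⊎ f n ≡ sucMod (f (suc n)))
  (no-backtrack : ∀ n → f (suc (suc n)) ≢ f n) where

  forward-steps : f 1 ≡ sucMod (f 0) → ∀ n → f (suc n) ≡ sucMod (f n)
  forward-steps first zero    = first
  forward-steps first (suc n) with step (suc n)
  ... | inj₁ fwd = fwd
  ... | inj₂ bwd = ⊥-elim (no-backtrack n (sucMod-injective (trans (sym bwd) (forward-steps first n))))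

  backward-steps : f 0 ≡ sucMod (f 1) → ∀ n → f n ≡ sucMod (f (suc n))
  backward-steps first zero    = first
  backward-steps first (suc n) with step (suc n)
  ... | inj₂ bwd = bwd
  ... | inj₁ fwd = ⊥-elim (no-backtrack n (trans fwd (sym (backward-steps first n))))

  orientation : (∀ n → f n ≡ rotate n (f 0)) ⊎ (∀ n → f 0 ≡ rotate n (f n))
  orientation with step 0
  ... | inj₁ first = inj₁ forward
    where
    forward : ∀ n → f n ≡ rotate n (f 0)
    forward zero    = refl
    forward (suc n) = trans (forward-steps first n) (cong sucMod (forward n))
  ... | inj₂ first = inj₂ backward
    where
    backward : ∀ n → f 0 ≡ rotate n (f n)
    backward zero    = refl
    backward (suc n) = trans (backward n) (trans (cong (rotate n) (backward-steps first n)) (rotate-sucMod n (f (suc n))))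

module SkeletonImage {n} (G : Graph (suc n)) (w : Fin (suc n)) (deg-w : deg G w ≡ 1)
  {k} (x : Fin (3 + k) → Fin (suc n)) (cycle : IsSkeletonCycle G k x)
  (π : Permutation′ (suc n))
  (π-off-w : ∀ a b → a ≢ w → b ≢ w → adj G a b ≡ adj G (π ⟨$⟩ʳ a) (π ⟨$⟩ʳ b)) where

  private
    x-injective : ∀ i j → x i ≡ x j → i ≡ j
    x-injective = proj₁ cycle
    x-deg≥2 : ∀ i → 2 ≤ deg G (x i)
    x-deg≥2 = proj₁ (proj₂ cycle)
    x-covers-deg≥2 : ∀ u → 2 ≤ deg G u → ∃ λ i → x i ≡ u
    x-covers-deg≥2 = proj₁ (proj₂ (proj₂ cycle))
    x-adjacency : ∀ i j → (adj G (x i) (x j) ≡ true → (j ≡ sucMod i ⊎ i ≡ sucMod j)) ×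
                          ((j ≡ sucMod i ⊎ i ≡ sucMod j) → adj G (x i) (x j) ≡ true)
    x-adjacency = proj₂ (proj₂ (proj₂ cycle))

  x≢w : ∀ i → x i ≢ w
  x≢w i refl with subst (2 ≤_) deg-w (x-deg≥2 i)
  ... | s≤s ()

  x~x-sucMod : ∀ i → adj G (x i) (x (sucMod i)) ≡ true
  x~x-sucMod i = proj₂ (x-adjacency i (sucMod i)) (inj₁ refl)

  x~x-predMod : ∀ i → adj G (x i) (x (predMod i)) ≡ true
  x~x-predMod i = proj₂ (x-adjacency i (predMod i)) (inj₂ (sym (sucMod-predMod i)))

  π-preserves-x~ : ∀ {i j} → adj G (x i) (x j) ≡ true → adj G (π ⟨$⟩ʳ x i) (π ⟨$⟩ʳ x j) ≡ true
  π-preserves-x~ {i} {j} x~ = trans (sym (π-off-w (x i) (x j) (x≢w i) (x≢w j))) x~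

  2≤deg-π-x : ∀ i → 2 ≤ deg G (π ⟨$⟩ʳ x i)
  2≤deg-π-x i = two-neighbours⇒2≤deg G (π ⟨$⟩ʳ x i) distinct
    (π-preserves-x~ (x~x-sucMod i)) (π-preserves-x~ (x~x-predMod i))
    where
    distinct : π ⟨$⟩ʳ x (sucMod i) ≢ π ⟨$⟩ʳ x (predMod i)
    distinct eq = sucMod²≢id i
      (trans (cong sucMod (x-injective _ _ (Injection.injective (↔⇒↣ π) eq))) (sucMod-predMod i))

  image : Fin (3 + k) → Fin (3 + k)
  image i = proj₁ (x-covers-deg≥2 (π ⟨$⟩ʳ x i) (2≤deg-π-x i))

  x-image : ∀ i → x (image i) ≡ π ⟨$⟩ʳ x i
  x-image i = proj₂ (x-covers-deg≥2 (π ⟨$⟩ʳ x i) (2≤deg-π-x i))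

  walk : ℕ → Fin (3 + k)
  walk m = image (rotate m zero)

  walk-step : ∀ m → walk (suc m) ≡ sucMod (walk m) ⊎ walk m ≡ sucMod (walk (suc m))
  walk-step m = proj₁ (x-adjacency (walk m) (walk (suc m)))
    (subst₂ (λ a b → adj G a b ≡ true) (sym (x-image _)) (sym (x-image _))
      (π-preserves-x~ (x~x-sucMod (rotate m zero))))

  walk-no-backtrack : ∀ m → walk (suc (suc m)) ≢ walk m
  walk-no-backtrack m eq = sucMod²≢id (rotate m zero) (x-injective _ _ (Injection.injective (↔⇒↣ π)
    (trans (sym (x-image _)) (trans (cong x eq) (x-image _)))))

  open NonBacktrackingWalk walk walk-step walk-no-backtrack public using (orientation)

module _ {n} (G : Graph (suc n)) (w : Fin (suc n)) (deg-w : deg G w ≡ 1)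
  {k} (x : Fin (3 + k) → Fin (suc n)) (cycle : IsSkeletonCycle G k x)
  (x₀~w : adj G (x zero) w ≡ true)
  (σ : Permutation′ (suc n)) (σ-aut : IsAut G σ)
  (α : Fin (3 + k)) (σ-rotates : ∀ i → σ ⟨$⟩ʳ x i ≡ x (addMod i α))
  (σ-moves-x₀ : σ ⟨$⟩ʳ x zero ≢ x zero)
  (π : Permutation′ (suc n))
  (π-off-w : ∀ a b → a ≢ w → b ≢ w → adj G a b ≡ adj G (π ⟨$⟩ʳ a) (π ⟨$⟩ʳ b)) where

  open OffVertex G w π π-off-w
  open SkeletonImage G w deg-w x cycle π π-off-w

  private
    a : ℕ
    a = toℕ α

  σ-x₀ : σ ⟨$⟩ʳ x zero ≡ x α
  σ-x₀ = trans (σ-rotates zero) (cong x (trans (addMod≡rotate zero α) (rotate-zero α)))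

  deg-x-rotate : ∀ i → deg G (x (rotate a i)) ≡ deg G (x i)
  deg-x-rotate i = trans (cong (λ j → deg G (x j)) (sym (addMod≡rotate i α)))
    (trans (cong (deg G) (sym (σ-rotates i))) (deg-aut G σ σ-aut (x i)))

  deg-x-α : deg G (x α) ≡ deg G (x zero)
  deg-x-α = trans (cong (deg G) (sym σ-x₀)) (deg-aut G σ σ-aut (x zero))

  deg-π-x-α : deg G (π ⟨$⟩ʳ x α) ≡ deg G (π ⟨$⟩ʳ x zero)
  deg-π-x-α = along orientation
    where
    open ≡-Reasoning
    along : (∀ m → walk m ≡ rotate m (walk 0)) ⊎ (∀ m → walk 0 ≡ rotate m (walk m)) →
            deg G (π ⟨$⟩ʳ x α) ≡ deg G (π ⟨$⟩ʳ x zero)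
    along (inj₁ forward) = begin
      deg G (π ⟨$⟩ʳ x α)               ≡⟨ cong (λ j → deg G (π ⟨$⟩ʳ x j)) (rotate-zero α) ⟨
      deg G (π ⟨$⟩ʳ x (rotate a zero)) ≡⟨ cong (deg G) (x-image (rotate a zero)) ⟨
      deg G (x (walk a))               ≡⟨ cong (λ j → deg G (x j)) (forward a) ⟩
      deg G (x (rotate a (walk 0)))    ≡⟨ deg-x-rotate (walk 0) ⟩
      deg G (x (walk 0))               ≡⟨ cong (deg G) (x-image zero) ⟩
      deg G (π ⟨$⟩ʳ x zero)            ∎
    along (inj₂ backward) = begin
      deg G (π ⟨$⟩ʳ x α)               ≡⟨ cong (λ j → deg G (π ⟨$⟩ʳ x j)) (rotate-zero α) ⟨
      deg G (π ⟨$⟩ʳ x (rotate a zero)) ≡⟨ cong (deg G) (x-image (rotate a zero)) ⟨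
      deg G (x (walk a))               ≡⟨ deg-x-rotate (walk a) ⟨
      deg G (x (rotate a (walk a)))    ≡⟨ cong (λ j → deg G (x j)) (backward a) ⟨
      deg G (x (walk 0))               ≡⟨ cong (deg G) (x-image zero) ⟩
      deg G (π ⟨$⟩ʳ x zero)            ∎

  w~-unique : ∀ {b} → adj G w b ≡ true → b ≡ x zero
  w~-unique w~b = leaf-neighbour-unique G w deg-w w~b (trans (Graph.sym G w (x zero)) x₀~w)

  x-α≁w : adj G (x α) w ≡ false
  x-α≁w with adj G (x α) w in x-α~w
  ... | false = refl
  ... | true  = ⊥-elim (σ-moves-x₀ (trans σ-x₀ (w~-unique (trans (Graph.sym G w (x α)) x-α~w))))

  π-x₀~π-w : adj G (π ⟨$⟩ʳ x zero) (π ⟨$⟩ʳ w) ≡ true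
  π-x₀~π-w with adj G (π ⟨$⟩ʳ x zero) (π ⟨$⟩ʳ w) in π-x₀~π-w
  ... | true  = refl
  ... | false = ⊥-elim (ℕ.<-irrefl refl (begin-strict
    degOff G w (x zero)        <⟨ ℕ.n<1+n _ ⟩
    1 + degOff G w (x zero)    ≡⟨ cong (λ b → indicator b + degOff G w (x zero)) x₀~w ⟨
    indicator (adj G (x zero) w) + degOff G w (x zero)
                               ≡⟨ deg-remove G w (x zero) ⟨
    deg G (x zero)             ≡⟨ deg-x-α ⟨
    deg G (x α)                ≡⟨ deg-remove G w (x α) ⟩
    indicator (adj G (x α) w) + degOff G w (x α)
                               ≡⟨ cong (λ b → indicator b + degOff G w (x α)) x-α≁w ⟩
    degOff G w (x α)           ≤⟨ m≤n+m _ _ ⟩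
    indicator (adj G (π ⟨$⟩ʳ x α) (π ⟨$⟩ʳ w)) + degOff G w (x α)
                               ≡⟨ deg-image (x α) (x≢w α) ⟨
    deg G (π ⟨$⟩ʳ x α)         ≡⟨ deg-π-x-α ⟩
    deg G (π ⟨$⟩ʳ x zero)      ≡⟨ deg-image (x zero) (x≢w zero) ⟩
    indicator (adj G (π ⟨$⟩ʳ x zero) (π ⟨$⟩ʳ w)) + degOff G w (x zero)
                               ≡⟨ cong (λ b → indicator b + degOff G w (x zero)) π-x₀~π-w ⟩
    degOff G w (x zero)        ∎))
    where open ℕ.≤-Reasoning

  π-preserves-w~ : ∀ b → adj G w b ≡ adj G (π ⟨$⟩ʳ w) (π ⟨$⟩ʳ b)
  π-preserves-w~ b = ⇔→≡ (mk⇔ to from)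
    where
    π-w~π-x₀ : adj G (π ⟨$⟩ʳ w) (π ⟨$⟩ʳ x zero) ≡ true
    π-w~π-x₀ = trans (Graph.sym G _ _) π-x₀~π-w
    to : adj G w b ≡ true → adj G (π ⟨$⟩ʳ w) (π ⟨$⟩ʳ b) ≡ true
    to w~b = subst (λ c → adj G (π ⟨$⟩ʳ w) (π ⟨$⟩ʳ c) ≡ true) (sym (w~-unique w~b)) π-w~π-x₀
    from : adj G (π ⟨$⟩ʳ w) (π ⟨$⟩ʳ b) ≡ true → adj G w b ≡ true
    from π-w~π-b = subst (λ c → adj G w c ≡ true)
      (sym (Injection.injective (↔⇒↣ π)
        (leaf-neighbour-unique G (π ⟨$⟩ʳ w) (trans deg-image-centre deg-w) π-w~π-b π-w~π-x₀)))
      (trans (Graph.sym G w (x zero)) x₀~w)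

  off-leaf-isomorphism-is-aut : IsAut G π
  off-leaf-isomorphism-is-aut u v with u ≟ w | v ≟ w
  ... | yes refl | _        = π-preserves-w~ v
  ... | no _     | yes refl = trans (Graph.sym G u w) (trans (π-preserves-w~ u) (Graph.sym G _ _))
  ... | no u≢w   | no v≢w   = π-off-w u v u≢w v≢w

aut∈BU : ∀ {N} (G : Graph N) {w v} (π : Permutation′ N) → deg G w ≢ deg G v → IsAut G π → InBU G w v π
aut∈BU G {w} π deg-w≢deg-v π-aut =
  ((λ π-w≡v → deg-w≢deg-v (trans (sym (deg-aut G π π-aut w)) (cong (deg G) π-w≡v))) ,
   (λ a b _ _ _ _ → π-aut a b)) ,
  (λ a b _ _ → π-aut a b)

lemma4p13 : (m : ℕ) (U T : Graph (suc m)) →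
  Sunshine U → Caterpillar T → DeckCommon≥ 5 U T →
  (U⁺ : Graph (suc (suc m))) (w v : Fin (suc (suc m))) →
  SunshineSupercard U T U⁺ w v →
  (k : ℕ) (x : Fin (3 + k) → Fin (suc (suc m))) → IsSkeletonCycle U⁺ k x →
  adj U⁺ (x zero) w ≡ true →
  (ν : Fin (3 + k)) → x ν ≡ v →
  deg U⁺ (x (sucMod ν)) ≤ deg U⁺ (x (predMod ν)) →
  (χ : ℕ) → ChiIs U⁺ w v χ →
  ((U′ : Graph (suc (suc m))) (w′ v′ : Fin (suc (suc m))) →
     SunshineSupercard U T U′ w′ v′ → (χ′ : ℕ) → ChiIs U′ w′ v′ χ′ → χ′ ≤ χ) →
  (σ : Permutation′ (suc (suc m))) → IsAut U⁺ σ → InBU U⁺ w v σ →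
  (α : Fin (3 + k)) → (∀ i → σ ⟨$⟩ʳ x i ≡ x (addMod i α)) →
  σ ⟨$⟩ʳ x zero ≢ x zero →
  (π : Permutation′ (suc (suc m))) →
    (InBU U⁺ w v π → IsAut U⁺ π) × (IsAut U⁺ π → InBU U⁺ w v π)
lemma4p13 _ _ _ _ _ _ U⁺ w v (_ , deg-w , deg-v , _) k x cycle x₀~w _ _ _ _ _ _
          σ σ-aut _ α σ-rotates σ-moves-x₀ π =
  (λ π∈BU → off-leaf-isomorphism-is-aut U⁺ w deg-w x cycle x₀~w σ σ-aut α σ-rotates σ-moves-x₀ π (proj₂ π∈BU)) ,
  aut∈BU U⁺ π (λ 1≡2 → 1≢2 (trans (sym deg-w) (trans 1≡2 deg-v)))
  where
  1≢2 : 1 ≢ 2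
  1≢2 ()
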